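{- Let $G$ be a graph with $n$ vertices, $m<n-1$ edges, and minimum degree at least one. Then $\mu(G)\le \mu(K_{1,p}\cup qK_2)$, where $p=2m-n+1$ and $q=n-m-1$.
   Context: For a graph $G$, $\mu(G)=2\#(G,K_3)+\#(G,P_3)$, where $\#(G,K_3)$ is the number of 3-subsets of $V(G)$ inducing a triangle and $\#(G,P_3)$ is the number of 3-subsets inducing a path with two edges. $K_{1,p}\cup qK_2$ is the disjoint union of a star with $p$ leaves and $q$ disjoint edges. -}

module Defs where

open import Data.Nat using (ℕ; zero; suc; _+_; _*_; _∸_; _<ᵇ_; _≡ᵇ_; _/_; _≤ᵇ_)
open import Data.Bool using (Bool; true; false; _∧_; _∨_; not; if_then_else_)
open import Data.Fin using (Fin; toℕ)
open import Data.List using (List; map; allFin)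
open import Data.Nat.ListAction using (sum)
open import Data.Product using (∃)
open import Relation.Binary.PropositionalEquality using (_≡_; refl; cong; cong₂)
open import Data.Bool.Properties using (∨-comm)

record Graph (n : ℕ) : Set where
  field
    adj    : Fin n → Fin n → Bool
    symm   : ∀ i j → adj i j ≡ adj j i
    irrefl : ∀ i → adj i i ≡ false
open Graph public

b2n : Bool → ℕ
b2n true  = 1
b2n false = 0

Σv : {n : ℕ} → (Fin n → ℕ) → ℕ
Σv {n} f = sum (map f (allFin n))

_<F_ : {n : ℕ} → Fin n → Fin n → Bool
i <F j = toℕ i <ᵇ toℕ j

edgeCount : {n : ℕ} → Graph n → ℕ
edgeCount G = Σv λ i → Σv λ j → b2n (i <F j ∧ adj G i j)

edgesIn : {n : ℕ} → Graph n → Fin n → Fin n → Fin n → ℕ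
edgesIn G i j k = b2n (adj G i j) + b2n (adj G i k) + b2n (adj G j k)

numK3 : {n : ℕ} → Graph n → ℕ
numK3 G = Σv λ i → Σv λ j → Σv λ k →
  b2n (i <F j ∧ j <F k ∧ (edgesIn G i j k ≡ᵇ 3))

numP3 : {n : ℕ} → Graph n → ℕ
numP3 G = Σv λ i → Σv λ j → Σv λ k →
  b2n (i <F j ∧ j <F k ∧ (edgesIn G i j k ≡ᵇ 2))

μ : {n : ℕ} → Graph n → ℕ
μ G = 2 * numK3 G + numP3 G

MinDegPos : {n : ℕ} → Graph n → Set
MinDegPos {n} G = ∀ (i : Fin n) → ∃ λ (j : Fin n) → adj G i j ≡ true

-- K_{1,p} ∪ qK_2 on vertex set {0,…,p+2q}: vertex 0 is the centre,
-- vertices 1..p the leaves, and for t < q the vertices p+1+2t, p+2+2t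
-- form a matching edge.  smR is the one-directional relation; the
-- adjacency is its symmetrization restricted to distinct vertices.
smR : ℕ → ℕ → ℕ → Bool
smR p a b =
  ((a ≡ᵇ 0) ∧ (1 ≤ᵇ b) ∧ (b ≤ᵇ p)) ∨
  ((p <ᵇ a) ∧ (p <ᵇ b) ∧ (((a ∸ suc p) / 2) ≡ᵇ ((b ∸ suc p) / 2)))

smAdjℕ : ℕ → ℕ → ℕ → Bool
smAdjℕ p a b = not (a ≡ᵇ b) ∧ (smR p a b ∨ smR p b a)

≡ᵇ-sym : ∀ a b → (a ≡ᵇ b) ≡ (b ≡ᵇ a)
≡ᵇ-sym zero zero = refl
≡ᵇ-sym zero (suc b) = refl
≡ᵇ-sym (suc a) zero = refl
≡ᵇ-sym (suc a) (suc b) = ≡ᵇ-sym a b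

≡ᵇ-refl : ∀ a → (a ≡ᵇ a) ≡ true
≡ᵇ-refl zero = refl
≡ᵇ-refl (suc a) = ≡ᵇ-refl a

starMatching : (p q : ℕ) → Graph (suc (p + 2 * q))
starMatching p q = record
  { adj = λ i j → smAdjℕ p (toℕ i) (toℕ j)
  ; symm = λ i j → cong₂ _∧_ (cong not (≡ᵇ-sym (toℕ i) (toℕ j)))
                     (∨-comm (smR p (toℕ i) (toℕ j)) (smR p (toℕ j) (toℕ i)))
  ; irrefl = λ i → cong (λ b → not b ∧ (smR p (toℕ i) (toℕ i) ∨ smR p (toℕ i) (toℕ i))) (≡ᵇ-refl (toℕ i))
  }

μStarMatching : ℕ → ℕ → ℕ
μStarMatching p q = μ (starMatching p q)

-- Count each induced 3-vertex configuration at its centres, the vertices adjacent to the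
-- other two: an induced P₃ has one centre and a triangle three, so
-- μ(G) ≤ Σ_v C(d(v), 2).  Writing d(v) = 1 + e(v), the handshake lemma gives
-- Σ_v e(v) ≤ 2m − n, and superadditivity of k ↦ k(k + 1) turns the bound into
-- 2μ(G) ≤ (2m − n)(2m − n + 1).  In K_{1,p} ∪ qK₂ with p = 2m − n + 1 every pair of
-- leaves spans an induced P₃ through the centre, which already accounts for that many.
module Submission where

open import Defs
open import Data.Bool using (Bool; true; false; _∧_; not)
open import Data.Bool.Properties using (∧-identityʳ; ∧-zeroʳ; T-≡)
open import Data.Fin using (Fin; zero; suc; toℕ)
open import Data.Fin.Properties using (toℕ-injective)
open import Data.List using (tabulate)
open import Data.List.Properties using (map-tabulate)
open import Data.Nat using (ℕ; zero; suc; _+_; _*_; _∸_; _<_; _≤_; z≤n; s≤s; _<ᵇ_; _≤ᵇ_; _≡ᵇ_)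
open import Data.Nat.ListAction using () renaming (sum to sumᴸ)
open import Data.Nat.Properties
open import Data.Nat.Solver using (module +-*-Solver)
open import Data.Product using (_,_)
open import Function using (_∘_; id; Equivalence)
open import Relation.Binary using (tri<; tri≈; tri>)
open import Relation.Binary.PropositionalEquality using (_≡_; refl; sym; trans; cong; cong₂; module ≡-Reasoning)

open import Algebra.Properties.Semiring.Sum +-*-semiring
  using (sum; sum-syntax; sum-cong-≗; sum-replicate-zero; ∑-distrib-+; ∑-comm; *-distribˡ-sum)
open +-*-Solver using (solve; _:=_; con; _:+_; _:*_)

sumᴸ-tabulate : ∀ {n} (f : Fin n → ℕ) → sumᴸ (tabulate f) ≡ sum f
sumᴸ-tabulate {zero}  f = refl
sumᴸ-tabulate {suc n} f = cong (f zero +_) (sumᴸ-tabulate (λ i → f (suc i)))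

Σv≡sum : ∀ {n} (f : Fin n → ℕ) → Σv f ≡ sum f
Σv≡sum f = trans (cong sumᴸ (map-tabulate id f)) (sumᴸ-tabulate f)

sum-mono-≤ : ∀ {n} {f g : Fin n → ℕ} → (∀ i → f i ≤ g i) → sum f ≤ sum g
sum-mono-≤ {zero}  _   = z≤n
sum-mono-≤ {suc n} f≤g = +-mono-≤ (f≤g zero) (sum-mono-≤ (λ i → f≤g (suc i)))

term≤sum : ∀ {n} (f : Fin n → ℕ) (i : Fin n) → f i ≤ sum f
term≤sum f zero    = m≤m+n _ _
term≤sum f (suc i) = ≤-trans (term≤sum (λ j → f (suc j)) i) (m≤n+m _ _)

sum-suc : ∀ {n} (f : Fin n → ℕ) → sum (λ i → suc (f i)) ≡ n + sum f
sum-suc {zero}  f = refl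
sum-suc {suc n} f = cong suc (begin
  f zero + sum (λ i → suc (f (suc i))) ≡⟨ cong (f zero +_) (sum-suc (λ i → f (suc i))) ⟩
  f zero + (n + sum (λ i → f (suc i))) ≡⟨ solve 3 (λ a b c → a :+ (b :+ c) := b :+ (a :+ c)) refl (f zero) n _ ⟩
  n + (f zero + sum (λ i → f (suc i))) ∎)
  where open ≡-Reasoning

-- pronic k = 2·C(k + 1, 2); working with doubled binomials avoids division.
pronic : ℕ → ℕ
pronic k = k * suc k

pronic-mono-≤ : ∀ {j k} → j ≤ k → pronic j ≤ pronic k
pronic-mono-≤ j≤k = *-mono-≤ j≤k (s≤s j≤k)

sum-pronic≤pronic-sum : ∀ {n} (f : Fin n → ℕ) → sum (pronic ∘ f) ≤ pronic (sum f)
sum-pronic≤pronic-sum {zero}  f = z≤n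
sum-pronic≤pronic-sum {suc n} f = begin
  pronic a + sum (λ i → pronic (f (suc i))) ≤⟨ +-monoʳ-≤ (pronic a) (sum-pronic≤pronic-sum (λ i → f (suc i))) ⟩
  pronic a + pronic s                        ≤⟨ m≤m+n _ (2 * a * s) ⟩
  pronic a + pronic s + 2 * a * s            ≡⟨ solve 2 (λ a s → a :* (con 1 :+ a) :+ s :* (con 1 :+ s) :+ con 2 :* a :* s
                                                               := (a :+ s) :* (con 1 :+ (a :+ s))) refl a s ⟩
  pronic (a + s)                             ∎
  where
  open ≤-Reasoning
  a = f zero
  s = sum (λ i → f (suc i))

∑³ : ∀ {n} → (Fin n → Fin n → Fin n → ℕ) → ℕ
∑³ {n} F = ∑[ i < n ] ∑[ j < n ] ∑[ k < n ] F i j k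

Σv³≡∑³ : ∀ {n} (F : Fin n → Fin n → Fin n → ℕ) → Σv (λ i → Σv λ j → Σv λ k → F i j k) ≡ ∑³ F
Σv³≡∑³ F = trans (Σv≡sum λ i → Σv λ j → Σv (F i j))
  (sum-cong-≗ λ i → trans (Σv≡sum λ j → Σv (F i j)) (sum-cong-≗ λ j → Σv≡sum (F i j)))

∑³-mono-≤ : ∀ {n} {F G : Fin n → Fin n → Fin n → ℕ} → (∀ i j k → F i j k ≤ G i j k) → ∑³ F ≤ ∑³ G
∑³-mono-≤ F≤G = sum-mono-≤ λ i → sum-mono-≤ λ j → sum-mono-≤ (F≤G i j)

∑³-distrib-+ : ∀ {n} (F G : Fin n → Fin n → Fin n → ℕ) → ∑³ (λ i j k → F i j k + G i j k) ≡ ∑³ F + ∑³ G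
∑³-distrib-+ F G = trans
  (sum-cong-≗ λ i → trans (sum-cong-≗ λ j → ∑-distrib-+ (F i j) (G i j))
                            (∑-distrib-+ (λ j → sum (F i j)) (λ j → sum (G i j))))
  (∑-distrib-+ (λ i → sum λ j → sum (F i j)) (λ i → sum λ j → sum (G i j)))

*-distribˡ-∑³ : ∀ {n} c (F : Fin n → Fin n → Fin n → ℕ) → c * ∑³ F ≡ ∑³ (λ i j k → c * F i j k)
*-distribˡ-∑³ c F = trans (*-distribˡ-sum c (λ i → sum λ j → sum (F i j)))
  (sum-cong-≗ λ i → trans (*-distribˡ-sum c (λ j → sum (F i j))) (sum-cong-≗ λ j → *-distribˡ-sum c (F i j)))

∑³-swap₁₂ : ∀ {n} (F : Fin n → Fin n → Fin n → ℕ) → ∑³ F ≡ ∑³ (λ j i k → F i j k)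
∑³-swap₁₂ F = ∑-comm (λ i j → sum (F i j))

∑³-rotate : ∀ {n} (F : Fin n → Fin n → Fin n → ℕ) → ∑³ F ≡ ∑³ (λ k i j → F i j k)
∑³-rotate F = trans (sum-cong-≗ λ i → ∑-comm (F i)) (∑-comm (λ i k → sum λ j → F i j k))

count : ∀ {n} → (Fin n → Bool) → ℕ
count {n} b = ∑[ i < n ] b2n (b i)

pairs : ∀ {n} → (Fin n → Bool) → ℕ
pairs {n} b = ∑[ i < n ] ∑[ j < n ] b2n (i <F j ∧ (b i ∧ b j))

pairs-count : ∀ {n} (b : Fin n → Bool) → 2 * pairs b + count b ≡ count b * count b
pairs-count {zero}  b = refl
pairs-count {suc n} b with b zero | pairs-count (λ i → b (suc i))
... | false | ih = trans (cong (λ s → 2 * (s + p) + c) (sum-replicate-zero n)) ih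
  where
  c = count (λ i → b (suc i))
  p = pairs (λ i → b (suc i))
... | true  | ih = begin
  2 * (c + p) + suc c        ≡⟨ solve 2 (λ c p → con 2 :* (c :+ p) :+ (con 1 :+ c)
                                                := (con 2 :* p :+ c) :+ (con 1 :+ con 2 :* c)) refl c p ⟩
  (2 * p + c) + suc (2 * c)  ≡⟨ cong (_+ suc (2 * c)) ih ⟩
  c * c + suc (2 * c)        ≡⟨ solve 1 (λ c → c :* c :+ (con 1 :+ con 2 :* c)
                                                := (con 1 :+ c) :* (con 1 :+ c)) refl c ⟩
  suc c * suc c              ∎
  where
  open ≡-Reasoning
  c = count (λ i → b (suc i))
  p = pairs (λ i → b (suc i))

double-pairs : ∀ {n} (b : Fin n → Bool) {k} → count b ≡ suc k → 2 * pairs b ≡ pronic k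
double-pairs b {k} count≡ = +-cancelʳ-≡ (suc k) _ _ (begin
  2 * pairs b + suc k    ≡⟨ cong (λ c → 2 * pairs b + c) count≡ ⟨
  2 * pairs b + count b  ≡⟨ pairs-count b ⟩
  count b * count b      ≡⟨ cong (λ c → c * c) count≡ ⟩
  suc k * suc k          ≡⟨ solve 1 (λ k → (con 1 :+ k) :* (con 1 :+ k) := k :* (con 1 :+ k) :+ (con 1 :+ k)) refl k ⟩
  pronic k + suc k       ∎)
  where open ≡-Reasoning

degree : ∀ {n} → Graph n → Fin n → ℕ
degree G v = count (adj G v)

adj≤oriented : ∀ {n} (G : Graph n) (i j : Fin n) →
  b2n (adj G i j) ≤ b2n (i <F j ∧ adj G i j) + b2n (j <F i ∧ adj G j i)
adj≤oriented G i j with <-cmp (toℕ i) (toℕ j)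
... | tri< i<j _ _ rewrite Equivalence.to T-≡ (<⇒<ᵇ i<j) = m≤m+n _ _
... | tri> _ _ j<i rewrite Equivalence.to T-≡ (<⇒<ᵇ j<i) | symm G j i = m≤n+m _ _
... | tri≈ _ i≡j _ rewrite toℕ-injective i≡j | irrefl G j = z≤n

sum-degree≤2*edgeCount : ∀ {n} (G : Graph n) → ∑[ v < n ] degree G v ≤ 2 * edgeCount G
sum-degree≤2*edgeCount {n} G = begin
  ∑[ i < n ] ∑[ j < n ] b2n (adj G i j)  ≤⟨ sum-mono-≤ (λ i → sum-mono-≤ (adj≤oriented G i)) ⟩
  ∑[ i < n ] ∑[ j < n ] (E i j + E j i)  ≡⟨ sum-cong-≗ (λ i → ∑-distrib-+ (E i) (λ j → E j i)) ⟩
  ∑[ i < n ] (∑[ j < n ] E i j + ∑[ j < n ] E j i)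
    ≡⟨ ∑-distrib-+ (λ i → ∑[ j < n ] E i j) (λ i → ∑[ j < n ] E j i) ⟩
  m + ∑[ i < n ] ∑[ j < n ] E j i        ≡⟨ cong (m +_) (∑-comm (λ i j → E j i)) ⟩
  m + m                                  ≡⟨ cong₂ _+_ edgeCount≡m (trans (+-identityʳ (edgeCount G)) edgeCount≡m) ⟨
  2 * edgeCount G                        ∎
  where
  open ≤-Reasoning
  E : Fin n → Fin n → ℕ
  E i j = b2n (i <F j ∧ adj G i j)
  m = ∑[ i < n ] ∑[ j < n ] E i j
  edgeCount≡m : edgeCount G ≡ m
  edgeCount≡m = trans (Σv≡sum λ i → Σv (E i)) (sum-cong-≗ λ i → Σv≡sum (E i))

excess : ∀ {n} → Graph n → Fin n → ℕ
excess G v = degree G v ∸ 1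

degree≡suc-excess : ∀ {n} (G : Graph n) → MinDegPos G → ∀ v → degree G v ≡ suc (excess G v)
degree≡suc-excess G minDeg v with minDeg v
... | w , v~w = sym (m+[n∸m]≡n (≤-trans (≤-reflexive (cong b2n (sym v~w))) (term≤sum (b2n ∘ adj G v) w)))

n+sum-excess≤2*edgeCount : ∀ {n} (G : Graph n) → MinDegPos G → n + ∑[ v < n ] excess G v ≤ 2 * edgeCount G
n+sum-excess≤2*edgeCount {n} G minDeg = begin
  n + ∑[ v < n ] excess G v        ≡⟨ sum-suc (excess G) ⟨
  ∑[ v < n ] suc (excess G v)      ≡⟨ sum-cong-≗ (degree≡suc-excess G minDeg) ⟨
  ∑[ v < n ] degree G v            ≤⟨ sum-degree≤2*edgeCount G ⟩
  2 * edgeCount G                  ∎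
  where open ≤-Reasoning

ordered : ∀ {n} → Fin n → Fin n → Fin n → Bool
ordered i j k = i <F j ∧ j <F k

commonNeighbour : ∀ {n} → Graph n → Fin n → Fin n → Fin n → Bool
commonNeighbour G v x y = adj G v x ∧ adj G v y

-- A triangle has three vertices adjacent to the other two, an induced P₃ exactly one.
centres-bound : ∀ c₁ c₂ x y z →
  2 * b2n (c₁ ∧ c₂ ∧ (b2n x + b2n y + b2n z ≡ᵇ 3)) + b2n (c₁ ∧ c₂ ∧ (b2n x + b2n y + b2n z ≡ᵇ 2))
  ≤ b2n ((c₁ ∧ c₂) ∧ (x ∧ y)) + b2n ((c₁ ∧ c₂) ∧ (x ∧ z)) + b2n ((c₁ ∧ c₂) ∧ (y ∧ z))
centres-bound false _     _     _     _     = z≤n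
centres-bound true  false _     _     _     = z≤n
centres-bound true  true  true  true  true  = ≤ᵇ⇒≤ _ _ _
centres-bound true  true  true  true  false = ≤ᵇ⇒≤ _ _ _
centres-bound true  true  true  false true  = ≤ᵇ⇒≤ _ _ _
centres-bound true  true  false true  true  = ≤ᵇ⇒≤ _ _ _
centres-bound true  true  true  false false = z≤n
centres-bound true  true  false true  false = z≤n
centres-bound true  true  false false true  = z≤n
centres-bound true  true  false false false = z≤n

<ᵇ-asym : ∀ u t → b2n (u <ᵇ t) + b2n (t <ᵇ u) ≤ 1
<ᵇ-asym zero    zero    = z≤n
<ᵇ-asym zero    (suc t) = ≤-refl
<ᵇ-asym (suc u) zero    = ≤-refl
<ᵇ-asym (suc u) (suc t) = <ᵇ-asym u t

-- u lies in at most one of the three gaps determined by s < t.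
betweenness : ∀ u s t →
  b2n ((u <ᵇ s) ∧ (s <ᵇ t)) + b2n ((s <ᵇ u) ∧ (u <ᵇ t)) + b2n ((s <ᵇ t) ∧ (t <ᵇ u)) ≤ b2n (s <ᵇ t)
betweenness (suc u) (suc s) (suc t) = betweenness u s t
betweenness zero    zero    zero    = z≤n
betweenness zero    zero    (suc t) = z≤n
betweenness zero    (suc s) zero    = z≤n
betweenness zero    (suc s) (suc t) with s <ᵇ t
... | true  = ≤-refl
... | false = z≤n
betweenness (suc u) zero    zero    = z≤n
betweenness (suc u) zero    (suc t) = <ᵇ-asym u t
betweenness (suc u) (suc s) zero    rewrite ∧-zeroʳ (u <ᵇ s) | ∧-zeroʳ (s <ᵇ u) = z≤n

∧-bound : ∀ {x y z w} → b2n x + b2n y + b2n z ≤ b2n w →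
  ∀ c → b2n (x ∧ c) + b2n (y ∧ c) + b2n (z ∧ c) ≤ b2n (w ∧ c)
∧-bound {x} {y} {z} {w} h true
  rewrite ∧-identityʳ x | ∧-identityʳ y | ∧-identityʳ z | ∧-identityʳ w = h
∧-bound {x} {y} {z} {w} _ false
  rewrite ∧-zeroʳ x | ∧-zeroʳ y | ∧-zeroʳ z | ∧-zeroʳ w = z≤n

μ≤sum-pairs : ∀ {n} (G : Graph n) → μ G ≤ ∑[ v < n ] pairs (adj G v)
μ≤sum-pairs {n} G = begin
  2 * numK3 G + numP3 G                ≡⟨ cong₂ (λ a b → 2 * a + b) (Σv³≡∑³ K₃) (Σv³≡∑³ P₃) ⟩
  2 * ∑³ K₃ + ∑³ P₃                    ≡⟨ cong (_+ ∑³ P₃) (*-distribˡ-∑³ 2 K₃) ⟩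
  ∑³ (λ i j k → 2 * K₃ i j k) + ∑³ P₃  ≡⟨ ∑³-distrib-+ (λ i j k → 2 * K₃ i j k) P₃ ⟨
  ∑³ (λ i j k → 2 * K₃ i j k + P₃ i j k)
    ≤⟨ ∑³-mono-≤ triangle-path-bound ⟩
  ∑³ (λ i j k → centre₁ i j k + centre₂ i j k + centre₃ i j k)
    ≡⟨ ∑³-split₃ centre₁ centre₂ centre₃ ⟩
  ∑³ centre₁ + ∑³ centre₂ + ∑³ centre₃
    ≡⟨ cong₂ (λ a b → ∑³ centre₁ + a + b) (∑³-swap₁₂ centre₂) (∑³-rotate centre₃) ⟩
  ∑³ centre₁ + ∑³ (λ v x y → centre₂ x v y) + ∑³ (λ v x y → centre₃ x y v)
    ≡⟨ ∑³-split₃ centre₁ (λ v x y → centre₂ x v y) (λ v x y → centre₃ x y v) ⟨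
  ∑³ (λ v x y → centre₁ v x y + centre₂ x v y + centre₃ x y v)
    ≤⟨ ∑³-mono-≤ centre-positions ⟩
  ∑[ v < n ] pairs (adj G v)           ∎
  where
  open ≤-Reasoning
  K₃ P₃ centre₁ centre₂ centre₃ : Fin n → Fin n → Fin n → ℕ
  K₃ i j k = b2n (i <F j ∧ j <F k ∧ (edgesIn G i j k ≡ᵇ 3))
  P₃ i j k = b2n (i <F j ∧ j <F k ∧ (edgesIn G i j k ≡ᵇ 2))
  centre₁ i j k = b2n (ordered i j k ∧ commonNeighbour G i j k)
  centre₂ i j k = b2n (ordered i j k ∧ commonNeighbour G j i k)
  centre₃ i j k = b2n (ordered i j k ∧ commonNeighbour G k i j)

  triangle-path-bound : ∀ i j k → 2 * K₃ i j k + P₃ i j k ≤ centre₁ i j k + centre₂ i j k + centre₃ i j k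
  triangle-path-bound i j k rewrite symm G j i | symm G k i | symm G k j =
    centres-bound (i <F j) (j <F k) (adj G i j) (adj G i k) (adj G j k)

  centre-positions : ∀ v x y → centre₁ v x y + centre₂ x v y + centre₃ x y v ≤ b2n (x <F y ∧ commonNeighbour G v x y)
  centre-positions v x y = ∧-bound {ordered v x y} {ordered x v y} {ordered x y v}
    (betweenness (toℕ v) (toℕ x) (toℕ y)) (commonNeighbour G v x y)

  ∑³-split₃ : (F G H : Fin n → Fin n → Fin n → ℕ) →
    ∑³ (λ i j k → F i j k + G i j k + H i j k) ≡ ∑³ F + ∑³ G + ∑³ H
  ∑³-split₃ F G H = trans (∑³-distrib-+ (λ i j k → F i j k + G i j k) H) (cong (_+ ∑³ H) (∑³-distrib-+ F G))

isLeaf : ℕ → ℕ → Bool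
isLeaf p x = (1 ≤ᵇ x) ∧ (x ≤ᵇ p)

count-<ᵇ : ∀ {n} r → r ≤ n → count {n} (λ x → toℕ x <ᵇ r) ≡ r
count-<ᵇ {n}     zero    _         = sum-replicate-zero n
count-<ᵇ {suc n} (suc r) (s≤s r≤n) = cong suc (count-<ᵇ r r≤n)

leaves : ∀ p q → Fin (suc (p + 2 * q)) → Bool
leaves p q = isLeaf p ∘ toℕ

count-leaves : ∀ p q → count (leaves p q) ≡ p
count-leaves p q = count-<ᵇ p (m≤m+n p (2 * q))

<ᵇ⇒≮ᵇsuc : ∀ j p → (j <ᵇ p) ≡ true → (p <ᵇ suc j) ≡ false
<ᵇ⇒≮ᵇsuc zero    (suc p) _   = refl
<ᵇ⇒≮ᵇsuc (suc j) (suc p) j<p = <ᵇ⇒≮ᵇsuc j p j<p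

leaf-pair-path : ∀ p j k →
  b2n ((j <ᵇ k) ∧ (isLeaf p j ∧ isLeaf p k)) ≤
  b2n ((0 <ᵇ j) ∧ (j <ᵇ k) ∧ (b2n (smAdjℕ p 0 j) + b2n (smAdjℕ p 0 k) + b2n (smAdjℕ p j k) ≡ᵇ 2))
leaf-pair-path p zero    zero    = z≤n
leaf-pair-path p zero    (suc k) = z≤n
leaf-pair-path p (suc j) zero    = z≤n
leaf-pair-path p (suc j) (suc k) with j <ᵇ k | j <ᵇ p in j<p | k <ᵇ p in k<p
... | false | _     | _     = z≤n
... | true  | false | _     = z≤n
... | true  | true  | false = z≤n
... | true  | true  | true
  rewrite <ᵇ⇒≮ᵇsuc j p j<p | <ᵇ⇒≮ᵇsuc k p k<p | ∧-zeroʳ (not (j ≡ᵇ k)) = ≤-refl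

pairs-leaves≤μStarMatching : ∀ p q → pairs (leaves p q) ≤ μStarMatching p q
pairs-leaves≤μStarMatching p q = begin
  pairs (leaves p q)      ≤⟨ sum-mono-≤ (λ j → sum-mono-≤ (leaf-pairs-centred-at-0 j)) ⟩
  sum (sum ∘ P₃ zero)     ≤⟨ term≤sum (λ i → sum (sum ∘ P₃ i)) zero ⟩
  ∑³ P₃                   ≡⟨ Σv³≡∑³ P₃ ⟨
  numP3 S                 ≤⟨ m≤n+m (numP3 S) (2 * numK3 S) ⟩
  μStarMatching p q       ∎
  where
  open ≤-Reasoning
  S = starMatching p q
  P₃ : Fin (suc (p + 2 * q)) → Fin (suc (p + 2 * q)) → Fin (suc (p + 2 * q)) → ℕ
  P₃ i j k = b2n (i <F j ∧ j <F k ∧ (edgesIn S i j k ≡ᵇ 2))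

  leaf-pairs-centred-at-0 : ∀ j k → b2n (j <F k ∧ (leaves p q j ∧ leaves p q k)) ≤ P₃ zero j k
  leaf-pairs-centred-at-0 j k = leaf-pair-path p (toℕ j) (toℕ k)

pronic≤2*μStarMatching : ∀ t q → pronic t ≤ 2 * μStarMatching (suc t) q
pronic≤2*μStarMatching t q = begin
  pronic t                      ≡⟨ double-pairs (leaves (suc t) q) (count-leaves (suc t) q) ⟨
  2 * pairs (leaves (suc t) q)  ≤⟨ *-monoʳ-≤ 2 (pairs-leaves≤μStarMatching (suc t) q) ⟩
  2 * μStarMatching (suc t) q   ∎
  where open ≤-Reasoning

2*μ≤pronic : ∀ {n} (G : Graph n) → MinDegPos G → 2 * μ G ≤ pronic (2 * edgeCount G ∸ n)
2*μ≤pronic {n} G minDeg = begin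
  2 * μ G                                ≤⟨ *-monoʳ-≤ 2 (μ≤sum-pairs G) ⟩
  2 * ∑[ v < n ] pairs (adj G v)         ≡⟨ *-distribˡ-sum 2 (pairs ∘ adj G) ⟩
  ∑[ v < n ] (2 * pairs (adj G v))       ≡⟨ sum-cong-≗ (λ v → double-pairs (adj G v) (degree≡suc-excess G minDeg v)) ⟩
  ∑[ v < n ] pronic (excess G v)         ≤⟨ sum-pronic≤pronic-sum (excess G) ⟩
  pronic (∑[ v < n ] excess G v)         ≤⟨ pronic-mono-≤ (m+n≤o⇒m≤o∸n (∑[ v < n ] excess G v) E+n≤2m) ⟩
  pronic (2 * edgeCount G ∸ n)           ∎
  where
  open ≤-Reasoning
  E+n≤2m : ∑[ v < n ] excess G v + n ≤ 2 * edgeCount G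
  E+n≤2m = ≤-trans (≤-reflexive (+-comm (∑[ v < n ] excess G v) n)) (n+sum-excess≤2*edgeCount G minDeg)

mainTheorem6 : (n : ℕ) (G : Graph n) →
    suc (edgeCount G) < n →
    MinDegPos G →
    μ G ≤ μStarMatching (2 * edgeCount G + 1 ∸ n) (n ∸ edgeCount G ∸ 1)
mainTheorem6 n G _ minDeg = *-cancelˡ-≤ 2 (begin
  2 * μ G                               ≤⟨ 2*μ≤pronic G minDeg ⟩
  pronic t                              ≤⟨ pronic≤2*μStarMatching t q ⟩
  2 * μStarMatching (suc t) q           ≡⟨ cong (λ p → 2 * μStarMatching p q) p≡suc-t ⟨
  2 * μStarMatching (2 * m + 1 ∸ n) q   ∎)
  where
  open ≤-Reasoning
  m = edgeCount G
  t = 2 * m ∸ n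
  q = n ∸ m ∸ 1
  n≤2m : n ≤ 2 * m
  n≤2m = m+n≤o⇒m≤o n (n+sum-excess≤2*edgeCount G minDeg)
  p≡suc-t : 2 * m + 1 ∸ n ≡ suc t
  p≡suc-t = trans (+-∸-comm 1 n≤2m) (+-comm t 1)
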